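{- Let $C$ be a program that terminates on all inputs (for every state $s$ there is $s'$ with $C:s\Rightarrow s'$) and $Q$ a predicate on states. Then the weakest precondition for $C$ and $Q$ with respect to Hoare triples coincides with the strongest precondition for $C$ and $Q$ with respect to access Hoare triples.
   Context: States are mappings from variables to values; programs are those of the while language (skip, assignment, sequential composition, if-then-else, while), with deterministic big-step execution relation $C:s\Rightarrow s'$ meaning execution of $C$ from $s$ terminates in $s'$. The Hoare triple $\{P\}\,C\,\{Q\}$ is valid iff $\forall s,s'\,[\,C:s\Rightarrow s'\wedge P(s)\rightarrow Q(s')\,]$; the access Hoare triple $\langle P\rangle\,C\,\langle Q\rangle$ is valid iff $\forall s,s'\,[\,C:s\Rightarrow s'\wedge Q(s')\rightarrow P(s)\,]$. A weakest precondition for $C,Q$ w.r.t. Hoare triples is a predicate $P'$ with: for all $P$, $\{P\}C\{Q\}$ valid iff $P\rightarrow P'$. A strongest precondition for $C,Q$ w.r.t. access Hoare triples is a predicate $P'$ with: for all $P$, $\langle P\rangle C\langle Q\rangle$ valid iff $P'\rightarrow P$. -}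

module Defs where

open import Data.Nat using (ℕ)
open import Data.Integer using (ℤ; _+_; _-_; _*_)
open import Data.Nat using () renaming (_≟_ to _ℕ≟_)
open import Relation.Nullary using (yes; no)
open import Data.Bool using (Bool; true; false; not; _∧_)
open import Data.Product using (_×_; Σ; _,_)
open import Relation.Nullary.Decidable using (⌊_⌋)
open import Relation.Binary.PropositionalEquality using (_≡_)
import Data.Integer.Properties as ℤP
open import Level using (Level; suc; _⊔_)

Var : Set
Var = ℕ

State : Set
State = Var → ℤ

update : State → Var → ℤ → State
update s x v y with x ℕ≟ y
... | yes _ = v
... | no  _ = s y

data AExp : Set where
  num  : ℤ → AExp
  var  : Var → AExp
  plus : AExp → AExp → AExp
  minus : AExp → AExp → AExp
  times : AExp → AExp → AExp

aval : AExp → State → ℤ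
aval (num n) s = n
aval (var x) s = s x
aval (plus a b) s = aval a s + aval b s
aval (minus a b) s = aval a s - aval b s
aval (times a b) s = aval a s * aval b s

data BExp : Set where
  bc   : Bool → BExp
  bnot : BExp → BExp
  band : BExp → BExp → BExp
  bleq : AExp → AExp → BExp

bval : BExp → State → Bool
bval (bc b) s = b
bval (bnot b) s = not (bval b s)
bval (band b c) s = bval b s ∧ bval c s
bval (bleq a b) s = ⌊ aval a s ℤP.≤? aval b s ⌋

data Com : Set where
  SKIP   : Com
  _::=_  : Var → AExp → Com
  _⨾_   : Com → Com → Com
  IF_THEN_ELSE_ : BExp → Com → Com → Com
  WHILE_DO_ : BExp → Com → Com

data _∶_⇒_ : Com → State → State → Set where
  Skip  : ∀ {s} → SKIP ∶ s ⇒ s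
  Assign : ∀ {x a s} → (x ::= a) ∶ s ⇒ update s x (aval a s)
  Seq   : ∀ {c₁ c₂ s₁ s₂ s₃} → c₁ ∶ s₁ ⇒ s₂ → c₂ ∶ s₂ ⇒ s₃ → (c₁ ⨾ c₂) ∶ s₁ ⇒ s₃
  IfTrue  : ∀ {b c₁ c₂ s t} → bval b s ≡ true  → c₁ ∶ s ⇒ t → (IF b THEN c₁ ELSE c₂) ∶ s ⇒ t
  IfFalse : ∀ {b c₁ c₂ s t} → bval b s ≡ false → c₂ ∶ s ⇒ t → (IF b THEN c₁ ELSE c₂) ∶ s ⇒ t
  WhileFalse : ∀ {b c s} → bval b s ≡ false → (WHILE b DO c) ∶ s ⇒ s
  WhileTrue  : ∀ {b c s₁ s₂ s₃} → bval b s₁ ≡ true → c ∶ s₁ ⇒ s₂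
             → (WHILE b DO c) ∶ s₂ ⇒ s₃ → (WHILE b DO c) ∶ s₁ ⇒ s₃

Pred : (ℓ : Level) → Set (suc ℓ)
Pred ℓ = State → Set ℓ

_⟶_ : ∀ {ℓ} → Pred ℓ → Pred ℓ → Set ℓ
P ⟶ Q = ∀ s → P s → Q s

HoareValid : ∀ {ℓ} → Pred ℓ → Com → Pred ℓ → Set ℓ
HoareValid P C Q = ∀ s s' → C ∶ s ⇒ s' → P s → Q s'

AccessValid : ∀ {ℓ} → Pred ℓ → Com → Pred ℓ → Set ℓ
AccessValid P C Q = ∀ s s' → C ∶ s ⇒ s' → Q s' → P s

_⇔_ : ∀ {a b} → Set a → Set b → Set (a ⊔ b)
A ⇔ B = (A → B) × (B → A)

IsWeakestPre : ∀ {ℓ} → Com → Pred ℓ → Pred ℓ → Set (suc ℓ)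
IsWeakestPre {ℓ} C Q P' = ∀ (P : Pred ℓ) → HoareValid P C Q ⇔ (P ⟶ P')

IsStrongestAccessPre : ∀ {ℓ} → Com → Pred ℓ → Pred ℓ → Set (suc ℓ)
IsStrongestAccessPre {ℓ} C Q P' = ∀ (P : Pred ℓ) → AccessValid P C Q ⇔ (P' ⟶ P)

Terminating : Com → Set
Terminating C = ∀ s → Σ State (λ s' → C ∶ s ⇒ s')

-- The Hoare weakest precondition of Q is the demonic "every run ends in Q",
-- the access strongest precondition is the angelic "some run ends in Q",
-- each determined up to equivalence of predicates.  Determinism makes the
-- angelic predicate imply the demonic one, and termination the converse.
module Submission where

open import Defs
open import Level using (Level)
open import Data.Product using (Σ; _,_; _×_; proj₁; proj₂)
open import Function using (id)
open import Relation.Binary.PropositionalEquality using (_≡_; refl; trans; sym; subst)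

⇒-deterministic : ∀ {C s t u} → C ∶ s ⇒ t → C ∶ s ⇒ u → t ≡ u
⇒-deterministic Skip Skip = refl
⇒-deterministic Assign Assign = refl
⇒-deterministic (Seq d₁ d₂) (Seq e₁ e₂) with ⇒-deterministic d₁ e₁
... | refl = ⇒-deterministic d₂ e₂
⇒-deterministic (IfTrue _ d) (IfTrue _ e) = ⇒-deterministic d e
⇒-deterministic (IfTrue b d) (IfFalse ¬b e) with trans (sym b) ¬b
... | ()
⇒-deterministic (IfFalse ¬b d) (IfTrue b e) with trans (sym ¬b) b
... | ()
⇒-deterministic (IfFalse _ d) (IfFalse _ e) = ⇒-deterministic d e
⇒-deterministic (WhileFalse _) (WhileFalse _) = refl
⇒-deterministic (WhileFalse ¬b) (WhileTrue b _ _) with trans (sym ¬b) b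
... | ()
⇒-deterministic (WhileTrue b _ _) (WhileFalse ¬b) with trans (sym b) ¬b
... | ()
⇒-deterministic (WhileTrue _ d₁ d₂) (WhileTrue _ e₁ e₂) with ⇒-deterministic d₁ e₁
... | refl = ⇒-deterministic d₂ e₂

module _ {ℓ : Level} where

  _≐_ : Pred ℓ → Pred ℓ → Set ℓ
  P ≐ R = (P ⟶ R) × (R ⟶ P)

  ≐-sym : {P R : Pred ℓ} → P ≐ R → R ≐ P
  ≐-sym (p⟶r , r⟶p) = r⟶p , p⟶r

  ≐-trans : {P R S : Pred ℓ} → P ≐ R → R ≐ S → P ≐ S
  ≐-trans (p⟶r , r⟶p) (r⟶s , s⟶r) =
    (λ s p → r⟶s s (p⟶r s p)) , (λ s x → r⟶p s (s⟶r s x))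

  wp : Com → Pred ℓ → Pred ℓ
  wp C Q s = ∀ s' → C ∶ s ⇒ s' → Q s'

  sp : Com → Pred ℓ → Pred ℓ
  sp C Q s = Σ State λ s' → (C ∶ s ⇒ s') × Q s'

  module _ (C : Com) (Q : Pred ℓ) (P' : Pred ℓ) where

    isWeakestPre⇔≐wp : IsWeakestPre C Q P' ⇔ (P' ≐ wp C Q)
    isWeakestPre⇔≐wp = to , from
      where
      to : IsWeakestPre C Q P' → P' ≐ wp C Q
      to weakest =
          (λ s p s' d → proj₂ (weakest P') (λ _ → id) s s' d p)
        , proj₁ (weakest (wp C Q)) (λ s s' d w → w s' d)
      from : P' ≐ wp C Q → IsWeakestPre C Q P'
      from (p'⟶wp , wp⟶p') P =
          (λ valid s p → wp⟶p' s (λ s' d → valid s s' d p))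
        , (λ p⟶p' s s' d p → p'⟶wp s (p⟶p' s p) s' d)

    isStrongestAccessPre⇔≐sp : IsStrongestAccessPre C Q P' ⇔ (P' ≐ sp C Q)
    isStrongestAccessPre⇔≐sp = to , from
      where
      to : IsStrongestAccessPre C Q P' → P' ≐ sp C Q
      to strongest =
          proj₁ (strongest (sp C Q)) (λ s s' d q → s' , d , q)
        , (λ s (s' , d , q) → proj₂ (strongest P') (λ _ → id) s s' d q)
      from : P' ≐ sp C Q → IsStrongestAccessPre C Q P'
      from (p'⟶sp , sp⟶p') P =
          (λ valid s p' → let (s' , d , q) = p'⟶sp s p' in valid s s' d q)
        , (λ p'⟶p s s' d q → p'⟶p s (sp⟶p' s (s' , d , q)))

  sp⟶wp : (C : Com) (Q : Pred ℓ) → sp C Q ⟶ wp C Q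
  sp⟶wp C Q s (s' , d , q) t e = subst Q (⇒-deterministic d e) q

  wp⟶sp : (C : Com) (Q : Pred ℓ) → Terminating C → wp C Q ⟶ sp C Q
  wp⟶sp C Q terminating s w = let (s' , d) = terminating s in s' , d , w s' d

  wp≐sp : (C : Com) (Q : Pred ℓ) → Terminating C → wp C Q ≐ sp C Q
  wp≐sp C Q terminating = wp⟶sp C Q terminating , sp⟶wp C Q

corollary5p6 : ∀ {ℓ : Level} (C : Com) (Q : Pred ℓ) → Terminating C →
    ∀ (P' : Pred ℓ) → IsWeakestPre C Q P' ⇔ IsStrongestAccessPre C Q P'
corollary5p6 C Q terminating P' =
    (λ weakest → from-sp (≐-trans (to-wp weakest) (wp≐sp C Q terminating)))
  , (λ strongest → from-wp (≐-trans (to-sp strongest) (≐-sym (wp≐sp C Q terminating))))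
  where
  open Σ (isWeakestPre⇔≐wp C Q P') renaming (proj₁ to to-wp; proj₂ to from-wp)
  open Σ (isStrongestAccessPre⇔≐sp C Q P') renaming (proj₁ to to-sp; proj₂ to from-sp)
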